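{- Let $q$ be a prime power, $n\ge1$, $b_0,\dots,b_{n-1}\in\mathbb{F}_{q^n}$, $B(x,y)=\mathrm{Tr}_{q^n/q}\bigl(\sum_{i=0}^{n-1}b_i x y^{q^i}\bigr)$, and suppose $x*y:=xy+B(x,y)$ defines a presemifield $(\mathbb{F}_{q^n},+,*)$. Let $A:\mathbb{F}_{q^n}\to\mathbb{F}_{q^n}$ satisfy $A(x)*1=x$ for every $x\in\mathbb{F}_{q^n}$. Then, with $t=\sum_{i=0}^{n-1}b_i$, one has $1+\mathrm{Tr}_{q^n/q}(t)\ne0$ and $$A(x)=x+\mathrm{Tr}_{q^n/q}\left(\frac{ -tx}{1+\mathrm{Tr}_{q^n/q}(t)}\right)\quad\text{for all }x\in\mathbb{F}_{q^n}.$$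
   Context: $\mathrm{Tr}_{q^n/q}$ denotes the trace map from $\mathbb{F}_{q^n}$ to $\mathbb{F}_q$. A presemifield is a finite set with operations $+,*$ such that $(\mathbb{S},+)$ is a group, both distributive laws hold, and $x*y=0$ implies $x=0$ or $y=0$ (no identity required). -}

module Defs where

open import Level using (0ℓ)
open import Algebra.Bundles using (CommutativeRing)
open import Data.Nat as ℕ using (ℕ; zero; suc)
open import Data.Nat.Primality using (Prime)
open import Data.Fin using (Fin)
import Data.Fin as Fin
open import Data.Product using (Σ; _×_; ∃)
open import Data.Sum using (_⊎_)
open import Relation.Nullary using (¬_)
open import Function.Bundles using (Bijection)
import Relation.Binary.PropositionalEquality as ≡

IsPrimePower : ℕ → Set
IsPrimePower q = Σ ℕ λ p → Σ ℕ λ k → Prime p × (1 ℕ.≤ k) × (q ≡.≡ p ℕ.^ k)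

record IsFieldRing (R : CommutativeRing 0ℓ 0ℓ) : Set where
  open CommutativeRing R
  field
    1≉0     : ¬ (1# ≈ 0#)
    inverse : ∀ x → ¬ (x ≈ 0#) → Σ Carrier λ y → x * y ≈ 1#

record IsFiniteFieldOfSize (R : CommutativeRing 0ℓ 0ℓ) (N : ℕ) : Set where
  field
    isField : IsFieldRing R
    card    : Bijection (CommutativeRing.setoid R) (≡.setoid (Fin N))

module _ (R : CommutativeRing 0ℓ 0ℓ) where
  open CommutativeRing R

  pow : Carrier → ℕ → Carrier
  pow x zero    = 1#
  pow x (suc m) = x * pow x m

  sumFin : (n : ℕ) → (Fin n → Carrier) → Carrier
  sumFin zero    f = 0#
  sumFin (suc n) f = f Fin.zero + sumFin n (λ i → f (Fin.suc i))

  Tr : (q n : ℕ) → Carrier → Carrier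
  Tr q n x = sumFin n (λ i → pow x (q ℕ.^ Fin.toℕ i))

  -- (Carrier, +, ∘) is a presemifield: (Carrier,+) is a group (given by R),
  -- both distributive laws hold, and there are no zero divisors.
  record IsPresemifield (_∘_ : Carrier → Carrier → Carrier) : Set where
    field
      psf-distribˡ : ∀ x y z → (x ∘ (y + z)) ≈ ((x ∘ y) + (x ∘ z))
      psf-distribʳ : ∀ x y z → ((y + z) ∘ x) ≈ ((y ∘ x) + (z ∘ x))
      psf-noZeroDivisors : ∀ x y → (x ∘ y) ≈ 0# → (x ≈ 0#) ⊎ (y ≈ 0#)

  Bform : (q n : ℕ) → (Fin n → Carrier) → Carrier → Carrier → Carrier
  Bform q n b x y = Tr q n (sumFin n (λ i → b i * x * pow y (q ℕ.^ Fin.toℕ i)))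

  starOp : (q n : ℕ) → (Fin n → Carrier) → Carrier → Carrier → Carrier
  starOp q n b x y = x * y + Bform q n b x y

module Submission where

open import Defs
open import Level using (0ℓ)
open import Algebra.Bundles using (CommutativeRing)
open import Data.Nat using (ℕ; _^_; _≥_)
open import Data.Fin using (Fin)
open import Data.Product using (Σ; _×_)
open import Relation.Nullary using (¬_)

open import Algebra.Bundles using (CommutativeMonoid)
open import Data.Nat as ℕ using (zero; suc; _<_; _∸_; _!; z≤n; s≤s)
import Data.Nat.Properties as ℕₚ
open import Data.Nat.Divisibility using (_∣_; _∤_; divides; ∣⇒≤; ∣1⇒≡1)
open import Data.Nat.Primality using (Prime; euclidsLemma; prime⇒nonZero; ¬prime[0]; ¬prime[1])
open import Data.Nat.Combinatorics using (_C_; nCk≡n!/k![n-k]!; k![n∸k]!∣n!; nCn≡1)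
open import Data.Nat.DivMod using (m/n*n≡m)
open import Data.Fin as Fin using (toℕ; fromℕ; inject₁; punchIn)
import Data.Fin.Properties as Finₚ
open import Data.Fin.Permutation using (Permutation; permutation)
open import Data.Product using (_,_)
open import Data.Sum using (inj₁; inj₂)
open import Data.Empty using (⊥-elim)
open import Function using (_∘_)
open import Function.Bundles using (Bijection; module Surjection)
import Algebra.Properties.CommutativeMonoid.Sum as CommutativeMonoidSum
open import Relation.Nullary using (Dec; yes; no)
open import Relation.Nullary.Decidable using (map′)
open import Relation.Binary.PropositionalEquality as ≡ using (_≡_; _≢_)

-- Since 1^(q^i) = 1, a ∗ 1 = a + Tr(t a); in particular d = 1 ∗ 1, which is
-- nonzero because a presemifield has no zero divisors.  The formula for A
-- only uses that Tr is additive, linear over 𝔽_q = {c | c^q = c} and takes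
-- values in 𝔽_q: for such a map the equation a + Tr(t a) = x is solved by
-- linear algebra (TraceEquation).  These properties of Tr follow from two
-- facts about the field F with q^n = p^(k n) elements: x^(q^n) = x (Fermat,
-- by permuting the nonzero elements) and additivity of x ↦ x^q (freshman's
-- dream, since p · 1 = 0 and p divides the inner binomial coefficients).

-- A prime does not divide m! for m < p: by Euclid's lemma it would divide
-- one of the factors 1, …, m, all of which are smaller than p.
prime∤factorial : ∀ {p} → Prime p → ∀ m → m < p → p ∤ m !
prime∤factorial pp zero    _   p∣1 = ¬prime[1] (≡.subst Prime (∣1⇒≡1 p∣1) pp)
prime∤factorial pp (suc m) m<p p∣m! with euclidsLemma (suc m) (m !) pp p∣m!
... | inj₁ p∣sm  = ℕₚ.<⇒≱ m<p (∣⇒≤ p∣sm)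
... | inj₂ p∣m!′ = prime∤factorial pp m (ℕₚ.<-trans (ℕₚ.n<1+n m) m<p) p∣m!′

n∣n! : ∀ n → .{{ℕ.NonZero n}} → n ∣ n !
n∣n! (suc n) = divides (n !) (ℕₚ.*-comm (suc n) (n !))

-- p divides the binomial coefficient p C k for 0 < k < p: it divides
-- p! = (p C k) · k! · (p ∸ k)!, but neither k! nor (p ∸ k)!.
prime∣choose : ∀ {p k} → Prime p → 0 < k → k < p → p ∣ p C k
prime∣choose {p} {k} pp 0<k k<p
  with euclidsLemma (p C k) (k ! ℕ.* (p ∸ k) !) pp p∣product
  where
  instance _ = k ℕₚ.!* (p ∸ k) !≢0
  product≡p! : (p C k) ℕ.* (k ! ℕ.* (p ∸ k) !) ≡ p !
  product≡p! = ≡.trans (≡.cong (ℕ._* (k ! ℕ.* (p ∸ k) !)) (nCk≡n!/k![n-k]! (ℕₚ.<⇒≤ k<p)))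
                       (m/n*n≡m (k![n∸k]!∣n! (ℕₚ.<⇒≤ k<p)))
  p∣product : p ∣ (p C k) ℕ.* (k ! ℕ.* (p ∸ k) !)
  p∣product = ≡.subst (p ∣_) (≡.sym product≡p!) (n∣n! p {{prime⇒nonZero pp}})
... | inj₁ p∣pCk = p∣pCk
... | inj₂ p∣k![p∸k]! with euclidsLemma (k !) ((p ∸ k) !) pp p∣k![p∸k]!
...   | inj₁ p∣k!     = ⊥-elim (prime∤factorial pp k k<p p∣k!)
...   | inj₂ p∣[p∸k]! = ⊥-elim (prime∤factorial pp (p ∸ k) (ℕₚ.∸-monoʳ-< 0<k (ℕₚ.<⇒≤ k<p)) p∣[p∸k]!)

module RingFacts (R : CommutativeRing 0ℓ 0ℓ) where
  open CommutativeRing R hiding (zero)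
  open import Relation.Binary.Reasoning.Setoid setoid
  open import Algebra.Properties.Semiring.Exp semiring using (^-congˡ; ^-assocʳ) renaming (_^_ to _^ᴿ_)
  open import Algebra.Properties.CommutativeSemiring.Exp commutativeSemiring using (^-distrib-*)
  open import Algebra.Properties.Semiring.Sum semiring
    using (sum; sum-cong-≋; sum-cong-≗; sum-init-last; ∑-distrib-+; *-distribˡ-sum; *-distribʳ-sum)
  open import Algebra.Properties.Semiring.Mult semiring
    using (×-congʳ; ×-homo-1; ×-assoc-*; ×1-homo-*) renaming (_×_ to _·_)
  open import Algebra.Properties.Group +-group using (∙-cancelˡ; x≈z//y; //-rightDividesˡ; inverseˡ-unique)
  open import Algebra.Properties.Ring ring using (x+x≈x⇒x≈0; -‿distribʳ-*)
  import Algebra.Properties.CommutativeSemiring.Binomial commutativeSemiring as Binomial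

  Σ< : ℕ → (ℕ → Carrier) → Carrier
  Σ< n g = sum (λ (i : Fin n) → g (toℕ i))

  pow≡^ : ∀ x m → pow R x m ≡ x ^ᴿ m
  pow≡^ x zero    = ≡.refl
  pow≡^ x (suc m) = ≡.cong (x *_) (pow≡^ x m)

  sumFin≡sum : ∀ m (f : Fin m → Carrier) → sumFin R m f ≡ sum f
  sumFin≡sum zero    f = ≡.refl
  sumFin≡sum (suc m) f = ≡.cong (f Fin.zero +_) (sumFin≡sum m (f ∘ Fin.suc))

  Tr≡Σ : ∀ q n x → Tr R q n x ≡ Σ< n (λ i → x ^ᴿ (q ^ i))
  Tr≡Σ q n x = ≡.trans (sumFin≡sum n _) (sum-cong-≗ {n} (λ i → pow≡^ x (q ^ toℕ i)))

  Tr-cong : ∀ q n {x y} → x ≈ y → Tr R q n x ≈ Tr R q n y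
  Tr-cong q n {x} {y} x≈y = begin
    Tr R q n x                  ≡⟨ Tr≡Σ q n x ⟩
    Σ< n (λ i → x ^ᴿ (q ^ i))   ≈⟨ sum-cong-≋ {n} (λ i → ^-congˡ (q ^ toℕ i) x≈y) ⟩
    Σ< n (λ i → y ^ᴿ (q ^ i))   ≡⟨ Tr≡Σ q n y ⟨
    Tr R q n y                  ∎

  1^m≈1 : ∀ m → 1# ^ᴿ m ≈ 1#
  1^m≈1 zero    = refl
  1^m≈1 (suc m) = trans (*-identityˡ _) (1^m≈1 m)

  star-by-one : ∀ q n b a → starOp R q n b a 1# ≈ a + Tr R q n (sumFin R n b * a)
  star-by-one q n b a = +-cong (*-identityʳ a) (Tr-cong q n (begin
    sumFin R n (λ i → b i * a * pow R 1# (q ^ toℕ i))  ≡⟨ sumFin≡sum n _ ⟩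
    sum (λ i → b i * a * pow R 1# (q ^ toℕ i))         ≈⟨ sum-cong-≋ {n} (λ i → drop-one (q ^ toℕ i)) ⟩
    sum (λ i → b i * a)                                ≈⟨ *-distribʳ-sum a b ⟨
    sum b * a                                          ≡⟨ ≡.cong (_* a) (sumFin≡sum n b) ⟨
    sumFin R n b * a                                   ∎))
    where
    drop-one : ∀ {c} m → c * pow R 1# m ≈ c
    drop-one m = trans (*-congˡ (trans (reflexive (pow≡^ 1# m)) (1^m≈1 m))) (*-identityʳ _)

  ^·1≈·1^ : ∀ a m → (a ^ m) · 1# ≈ (a · 1#) ^ᴿ m
  ^·1≈·1^ a zero    = ×-homo-1 1#
  ^·1≈·1^ a (suc m) = trans (×1-homo-* a (a ^ m)) (*-congˡ (^·1≈·1^ a m))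

  Additive : ℕ → Set
  Additive m = ∀ x y → (x + y) ^ᴿ m ≈ x ^ᴿ m + y ^ᴿ m

  additive-* : ∀ m k → Additive m → Additive k → Additive (m ℕ.* k)
  additive-* m k add-m add-k x y = begin
    (x + y) ^ᴿ (m ℕ.* k)             ≈⟨ ^-assocʳ (x + y) m k ⟨
    ((x + y) ^ᴿ m) ^ᴿ k              ≈⟨ ^-congˡ k (add-m x y) ⟩
    (x ^ᴿ m + y ^ᴿ m) ^ᴿ k           ≈⟨ add-k (x ^ᴿ m) (y ^ᴿ m) ⟩
    (x ^ᴿ m) ^ᴿ k + (y ^ᴿ m) ^ᴿ k    ≈⟨ +-cong (^-assocʳ x m k) (^-assocʳ y m k) ⟩
    x ^ᴿ (m ℕ.* k) + y ^ᴿ (m ℕ.* k)  ∎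

  additive-^ : ∀ m → Additive m → ∀ a → Additive (m ^ a)
  additive-^ m add-m zero    x y = trans (*-identityʳ _) (+-cong (sym (*-identityʳ x)) (sym (*-identityʳ y)))
  additive-^ m add-m (suc a) = additive-* m (m ^ a) add-m (additive-^ m add-m a)

  additive⇒0^m≈0 : ∀ m → Additive m → 0# ^ᴿ m ≈ 0#
  additive⇒0^m≈0 m add-m = x+x≈x⇒x≈0 _ (sym (trans (^-congˡ m (sym (+-identityʳ 0#))) (add-m 0# 0#)))

  additive-sum : ∀ m → Additive m → ∀ k (f : Fin k → Carrier) → sum f ^ᴿ m ≈ sum (λ i → f i ^ᴿ m)
  additive-sum m add-m zero    f = additive⇒0^m≈0 m add-m
  additive-sum m add-m (suc k) f = trans (add-m _ _) (+-congˡ (additive-sum m add-m k (f ∘ Fin.suc)))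

  sum-last : ∀ m (f : Fin (suc m) → Carrier) → (∀ j → toℕ j < m → f j ≈ 0#) → sum f ≈ f (fromℕ m)
  sum-last zero    f _      = +-identityʳ _
  sum-last (suc m) f vanish =
    trans (+-cong (vanish Fin.zero (s≤s z≤n)) (sum-last m (f ∘ Fin.suc) (λ j j<m → vanish (Fin.suc j) (s≤s j<m))))
          (+-identityˡ _)

  multiple-vanishes : ∀ {p c} → p · 1# ≈ 0# → ∀ z → p ∣ c → c · z ≈ 0#
  multiple-vanishes {p} p·1≈0 z (divides d ≡.refl) = begin
    (d ℕ.* p) · z          ≈⟨ ×-congʳ (d ℕ.* p) (*-identityˡ z) ⟨
    (d ℕ.* p) · (1# * z)   ≈⟨ ×-assoc-* (d ℕ.* p) 1# z ⟨
    ((d ℕ.* p) · 1#) * z   ≈⟨ *-congʳ (trans (×1-homo-* d p) (*-congˡ p·1≈0)) ⟩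
    ((d · 1#) * 0#) * z    ≈⟨ *-congʳ (zeroʳ _) ⟩
    0# * z                 ≈⟨ zeroˡ z ⟩
    0#                     ∎

  -- Freshman's dream: in characteristic p (a prime with p · 1 = 0) the
  -- p-th power map is additive, since all inner binomial coefficients vanish.
  freshman : ∀ {p} → Prime p → p · 1# ≈ 0# → Additive p
  freshman {zero}   pp _       = ⊥-elim (¬prime[0] pp)
  freshman {suc p′} pp p·1≈0 x y = begin
    (x + y) ^ᴿ suc p′                        ≈⟨ Binomial.theorem (suc p′) x y ⟩
    term Fin.zero + sum (term ∘ Fin.suc)     ≈⟨ +-cong first (sum-last p′ (term ∘ Fin.suc) inner) ⟩
    y ^ᴿ suc p′ + term (Fin.suc (fromℕ p′))  ≈⟨ +-congˡ last ⟩
    y ^ᴿ suc p′ + x ^ᴿ suc p′                ≈⟨ +-comm _ _ ⟩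
    x ^ᴿ suc p′ + y ^ᴿ suc p′                ∎
    where
    term : Fin (suc (suc p′)) → Carrier
    term = Binomial.binomialTerm x y (suc p′)
    first : term Fin.zero ≈ y ^ᴿ suc p′
    first = trans (×-homo-1 _) (*-identityˡ _)
    inner : ∀ j → toℕ j < p′ → term (Fin.suc j) ≈ 0#
    inner j j<p′ = multiple-vanishes p·1≈0 _ (prime∣choose pp (s≤s z≤n) (s≤s j<p′))
    last : term (Fin.suc (fromℕ p′)) ≈ x ^ᴿ suc p′
    last rewrite Finₚ.toℕ-fromℕ p′ | nCn≡1 (suc p′) | ℕₚ.n∸n≡0 p′ = trans (×-homo-1 _) (*-identityʳ _)

  sum-rotate : ∀ n (g : ℕ → Carrier) → g n ≈ g 0 → Σ< n (g ∘ suc) ≈ Σ< n g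
  sum-rotate n g gn≈g0 = ∙-cancelˡ (g 0) _ _ (begin
    g 0 + Σ< n (g ∘ suc)                                          ≈⟨ sum-init-last {n} (g ∘ toℕ) ⟩
    sum (λ (i : Fin n) → g (toℕ (inject₁ i))) + g (toℕ (fromℕ n))  ≡⟨ ≡.cong₂ _+_ (sum-cong-≗ {n} (≡.cong g ∘ Finₚ.toℕ-inject₁))
                                                                                   (≡.cong g (Finₚ.toℕ-fromℕ n)) ⟩
    Σ< n g + g n                                                  ≈⟨ +-comm _ _ ⟩
    g n + Σ< n g                                                  ≈⟨ +-congʳ gn≈g0 ⟩
    g 0 + Σ< n g                                                  ∎)

  module Trace (q n : ℕ) (q-additive : Additive q) (periodic : ∀ x → x ^ᴿ (q ^ n) ≈ x) where

    -- Fixed elements of the Frobenius x ↦ x^q (the subfield 𝔽_q).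
    Fixed : Carrier → Set
    Fixed c = c ^ᴿ q ≈ c

    fixed-1 : Fixed 1#
    fixed-1 = 1^m≈1 q

    fixed-+ : ∀ {c d} → Fixed c → Fixed d → Fixed (c + d)
    fixed-+ c-fixed d-fixed = trans (q-additive _ _) (+-cong c-fixed d-fixed)

    fixed-inverse : ∀ {d u} → Fixed d → d * u ≈ 1# → Fixed u
    fixed-inverse {d} {u} d-fixed du≈1 = begin
      u ^ᴿ q                  ≈⟨ *-identityʳ _ ⟨
      u ^ᴿ q * 1#             ≈⟨ *-congˡ du≈1 ⟨
      u ^ᴿ q * (d * u)        ≈⟨ *-assoc _ _ _ ⟨
      (u ^ᴿ q * d) * u        ≈⟨ *-congʳ (*-congˡ d-fixed) ⟨
      (u ^ᴿ q * d ^ᴿ q) * u   ≈⟨ *-congʳ (^-distrib-* u d q) ⟨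
      (u * d) ^ᴿ q * u        ≈⟨ *-congʳ (^-congˡ q (trans (*-comm u d) du≈1)) ⟩
      1# ^ᴿ q * u             ≈⟨ *-congʳ fixed-1 ⟩
      1# * u                  ≈⟨ *-identityˡ u ⟩
      u                       ∎

    conj : Carrier → ℕ → Carrier
    conj x i = x ^ᴿ (q ^ i)

    fixed-conj : ∀ {c} → Fixed c → ∀ i → conj c i ≈ c
    fixed-conj c-fixed zero        = *-identityʳ _
    fixed-conj {c} c-fixed (suc i) = begin
      c ^ᴿ (q ℕ.* q ^ i)    ≈⟨ ^-assocʳ c q (q ^ i) ⟨
      (c ^ᴿ q) ^ᴿ (q ^ i)   ≈⟨ ^-congˡ (q ^ i) c-fixed ⟩
      conj c i              ≈⟨ fixed-conj c-fixed i ⟩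
      c                     ∎

    Tr≈Σ : ∀ x → Tr R q n x ≈ Σ< n (conj x)
    Tr≈Σ x = reflexive (Tr≡Σ q n x)

    Tr-+ : ∀ x y → Tr R q n (x + y) ≈ Tr R q n x + Tr R q n y
    Tr-+ x y = begin
      Tr R q n (x + y)                  ≈⟨ Tr≈Σ (x + y) ⟩
      Σ< n (conj (x + y))               ≈⟨ sum-cong-≋ {n} (λ i → additive-^ q q-additive (toℕ i) x y) ⟩
      Σ< n (λ i → conj x i + conj y i)  ≈⟨ ∑-distrib-+ {n} _ _ ⟩
      Σ< n (conj x) + Σ< n (conj y)     ≈⟨ +-cong (Tr≈Σ x) (Tr≈Σ y) ⟨
      Tr R q n x + Tr R q n y           ∎

    Tr-linear : ∀ {c} → Fixed c → ∀ z → Tr R q n (c * z) ≈ c * Tr R q n z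
    Tr-linear {c} c-fixed z = begin
      Tr R q n (c * z)                  ≈⟨ Tr≈Σ (c * z) ⟩
      Σ< n (conj (c * z))               ≈⟨ sum-cong-≋ {n} (λ i → ^-distrib-* c z (q ^ toℕ i)) ⟩
      Σ< n (λ i → conj c i * conj z i)  ≈⟨ sum-cong-≋ {n} (λ i → *-congʳ (fixed-conj c-fixed (toℕ i))) ⟩
      Σ< n (λ i → c * conj z i)         ≈⟨ *-distribˡ-sum {n} c _ ⟨
      c * Σ< n (conj z)                 ≈⟨ *-congˡ (Tr≈Σ z) ⟨
      c * Tr R q n z                    ∎

    -- Tr(z)^q = Tr(z): raising to the q-th power shifts the conjugates
    -- cyclically, because z^(q^n) = z.
    Tr-fixed : ∀ z → Fixed (Tr R q n z)
    Tr-fixed z = begin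
      Tr R q n z ^ᴿ q              ≈⟨ ^-congˡ q (Tr≈Σ z) ⟩
      Σ< n (conj z) ^ᴿ q           ≈⟨ additive-sum q q-additive n _ ⟩
      Σ< n (λ i → conj z i ^ᴿ q)   ≈⟨ sum-cong-≋ {n} (λ i → conj-suc (toℕ i)) ⟩
      Σ< n (conj z ∘ suc)          ≈⟨ sum-rotate n (conj z) (trans (periodic z) (sym (*-identityʳ z))) ⟩
      Σ< n (conj z)                ≈⟨ Tr≈Σ z ⟨
      Tr R q n z                   ∎
      where
      conj-suc : ∀ i → conj z i ^ᴿ q ≈ conj z (suc i)
      conj-suc i = trans (^-assocʳ z (q ^ i) q) (reflexive (≡.cong (z ^ᴿ_) (ℕₚ.*-comm (q ^ i) q)))

  -- If a solves a + T(t a) = x and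
  -- u ∈ K inverts 1 + T(t), then a = x + T(-(t x) u): indeed c = T(t a) lies
  -- in K, so c = T(t x) - c T(t), i.e. c (1 + T(t)) = T(t x).
  module TraceEquation (K : Carrier → Set) (T : Carrier → Carrier)
                       (T-cong : ∀ {x y} → x ≈ y → T x ≈ T y)
                       (T-+ : ∀ x y → T (x + y) ≈ T x + T y)
                       (T-linear : ∀ {c} → K c → ∀ z → T (c * z) ≈ c * T z)
                       (T-in-K : ∀ z → K (T z)) where

    T-neg : ∀ z → T (- z) ≈ - T z
    T-neg z = inverseˡ-unique (T (- z)) (T z) (begin
      T (- z) + T z        ≈⟨ T-+ (- z) z ⟨
      T (- z + z)          ≈⟨ T-cong (-‿inverseˡ z) ⟩
      T 0#                 ≈⟨ x+x≈x⇒x≈0 (T 0#) (trans (sym (T-+ 0# 0#)) (T-cong (+-identityʳ 0#))) ⟩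
      0#                   ∎)

    solve : ∀ {t x a u} → K u → a + T (t * a) ≈ x → (1# + T t) * u ≈ 1# → a ≈ x + T ((- (t * x)) * u)
    solve {t} {x} {a} {u} u∈K a+c≈x du≈1 = begin
      a                        ≈⟨ x≈z//y a c x a+c≈x ⟩
      x + - c                  ≈⟨ +-congˡ T-value ⟨
      x + T ((- (t * x)) * u)  ∎
      where
      c : Carrier
      c = T (t * a)
      c≈ : c ≈ T (t * x) + - (c * T t)
      c≈ = begin
        T (t * a)                   ≈⟨ T-cong (*-congˡ (x≈z//y a c x a+c≈x)) ⟩
        T (t * (x + - c))           ≈⟨ T-cong (trans (distribˡ t x (- c)) (+-congˡ t·-c≈-ct)) ⟩
        T (t * x + - (c * t))       ≈⟨ T-+ _ _ ⟩
        T (t * x) + T (- (c * t))   ≈⟨ +-congˡ (trans (T-neg (c * t)) (-‿cong (T-linear (T-in-K (t * a)) t))) ⟩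
        T (t * x) + - (c * T t)     ∎
        where
        t·-c≈-ct : t * - c ≈ - (c * t)
        t·-c≈-ct = trans (sym (-‿distribʳ-* t c)) (-‿cong (*-comm t c))
      c·d≈ : c * (1# + T t) ≈ T (t * x)
      c·d≈ = begin
        c * (1# + T t)                        ≈⟨ trans (distribˡ c 1# (T t)) (+-congʳ (*-identityʳ c)) ⟩
        c + c * T t                           ≈⟨ +-congʳ c≈ ⟩
        (T (t * x) + - (c * T t)) + c * T t   ≈⟨ //-rightDividesˡ (c * T t) (T (t * x)) ⟩
        T (t * x)                             ∎
      T-value : T ((- (t * x)) * u) ≈ - c
      T-value = begin
        T ((- (t * x)) * u)      ≈⟨ T-cong (*-comm _ u) ⟩
        T (u * - (t * x))        ≈⟨ T-linear u∈K _ ⟩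
        u * T (- (t * x))        ≈⟨ *-congˡ (T-neg (t * x)) ⟩
        u * - T (t * x)          ≈⟨ -‿distribʳ-* u _ ⟨
        - (u * T (t * x))        ≈⟨ -‿cong (*-congˡ c·d≈) ⟨
        - (u * (c * (1# + T t))) ≈⟨ -‿cong (*-comm u _) ⟩
        - ((c * (1# + T t)) * u) ≈⟨ -‿cong (*-assoc c _ u) ⟩
        - (c * ((1# + T t) * u)) ≈⟨ -‿cong (trans (*-congˡ du≈1) (*-identityʳ c)) ⟩
        - c                      ∎

module FieldFacts (F : CommutativeRing 0ℓ 0ℓ) (isField : IsFieldRing F) where
  open CommutativeRing F hiding (zero)
  open IsFieldRing isField
  open import Relation.Binary.Reasoning.Setoid setoid
  open import Algebra.Properties.Semiring.Exp semiring using () renaming (_^_ to _^ᴿ_)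
  open CommutativeMonoidSum *-commutativeMonoid using () renaming (sum to product)

  *-cancelʳ-nonzero : ∀ {c} → ¬ c ≈ 0# → ∀ a b → a * c ≈ b * c → a ≈ b
  *-cancelʳ-nonzero {c} c≉0 a b ac≈bc with inverse c c≉0
  ... | c⁻¹ , cc⁻¹≈1 = begin
    a              ≈⟨ *-identityʳ a ⟨
    a * 1#         ≈⟨ *-congˡ cc⁻¹≈1 ⟨
    a * (c * c⁻¹)  ≈⟨ *-assoc a c c⁻¹ ⟨
    (a * c) * c⁻¹  ≈⟨ *-congʳ ac≈bc ⟩
    (b * c) * c⁻¹  ≈⟨ *-assoc b c c⁻¹ ⟩
    b * (c * c⁻¹)  ≈⟨ *-congˡ cc⁻¹≈1 ⟩
    b * 1#         ≈⟨ *-identityʳ b ⟩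
    b              ∎

  *-nonzero : ∀ {x y} → ¬ x ≈ 0# → ¬ y ≈ 0# → ¬ x * y ≈ 0#
  *-nonzero {x} {y} x≉0 y≉0 xy≈0 = x≉0 (*-cancelʳ-nonzero y≉0 x 0# (trans xy≈0 (sym (zeroˡ y))))

  ^-nonzero : ∀ {x} m → ¬ x ≈ 0# → ¬ x ^ᴿ m ≈ 0#
  ^-nonzero zero    x≉0 = 1≉0
  ^-nonzero (suc m) x≉0 = *-nonzero x≉0 (^-nonzero m x≉0)

  product-nonzero : ∀ m (f : Fin m → Carrier) → (∀ j → ¬ f j ≈ 0#) → ¬ product f ≈ 0#
  product-nonzero zero    f _  = 1≉0
  product-nonzero (suc m) f nz = *-nonzero (nz Fin.zero) (product-nonzero m (f ∘ Fin.suc) (nz ∘ Fin.suc))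

module _ (M : CommutativeMonoid 0ℓ 0ℓ) where
  open CommutativeMonoid M
  open import Algebra.Properties.CommutativeMonoid.Sum M using (sum; sum-remove; sum-cong-≋; sum-replicate)
  open import Algebra.Definitions.RawMonoid rawMonoid using () renaming (_×_ to _·_)

  sum-all-but-one : ∀ {m} (f : Fin m → Carrier) (i : Fin m) {x} →
                    f i ≈ ε → (∀ j → j ≢ i → f j ≈ x) → sum f ≈ (m ∸ 1) · x
  sum-all-but-one {suc m} f i {x} fi≈ε others =
    trans (sum-remove {i = i} f)
          (trans (∙-cong fi≈ε (sum-cong-≋ (λ j → others (punchIn i j) (Finₚ.punchInᵢ≢i i j))))
                 (trans (identityˡ _) (sum-replicate m)))

-- Summing a function over all its elements is invariant under
-- translation by a unit, since translation permutes the elements.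
module Enumeration (M : CommutativeMonoid 0ℓ 0ℓ) {N : ℕ}
                   (card : Bijection (CommutativeMonoid.setoid M) (≡.setoid (Fin N))) where
  open CommutativeMonoid M
  open import Algebra.Properties.CommutativeMonoid.Sum M using (sum; sum-permute; sum-cong-≋)
  open Bijection card using (to; injective; to⁻) renaming (cong to to-cong)

  to∘to⁻ : ∀ j → to (to⁻ j) ≡ j
  to∘to⁻ = Surjection.to∘to⁻ (Bijection.surjection card)

  to⁻∘to : ∀ x → to⁻ (to x) ≈ x
  to⁻∘to x = injective (to∘to⁻ (to x))

  _≈?_ : ∀ x y → Dec (x ≈ y)
  x ≈? y = map′ injective to-cong (to x Fin.≟ to y)

  total : (Carrier → Carrier) → Carrier
  total g = sum (λ j → g (to⁻ j))

  total-translate : ∀ {a a′} → a′ ∙ a ≈ ε → (g : Carrier → Carrier) → (∀ {x y} → x ≈ y → g x ≈ g y) →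
                    total g ≈ total (λ x → g (a ∙ x))
  total-translate {a} {a′} a′a≈ε g g-cong =
    trans (sum-permute (g ∘ to⁻) translation) (sum-cong-≋ {N} (λ j → g-cong (to⁻∘to (a ∙ to⁻ j))))
    where
    cancel : ∀ b b′ → b′ ∙ b ≈ ε → ∀ x → b ∙ (b′ ∙ x) ≈ x
    cancel b b′ b′b≈ε x = trans (sym (assoc b b′ x)) (trans (∙-congʳ (trans (comm b b′) b′b≈ε)) (identityˡ x))
    inverse-on-indices : ∀ b b′ → b′ ∙ b ≈ ε → ∀ j → to (b ∙ to⁻ (to (b′ ∙ to⁻ j))) ≡ j
    inverse-on-indices b b′ b′b≈ε j =
      ≡.trans (to-cong (trans (∙-congˡ (to⁻∘to _)) (cancel b b′ b′b≈ε (to⁻ j)))) (to∘to⁻ j)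
    translation : Permutation N N
    translation = permutation (λ j → to (a ∙ to⁻ j)) (λ j → to (a′ ∙ to⁻ j))
                              (inverse-on-indices a a′ a′a≈ε)
                              (inverse-on-indices a′ a (trans (comm a a′) a′a≈ε))

module FiniteFieldFacts (F : CommutativeRing 0ℓ 0ℓ) (isField : IsFieldRing F) {N : ℕ}
                        (card : Bijection (CommutativeRing.setoid F) (≡.setoid (Fin N))) where
  open CommutativeRing F hiding (zero)
  open IsFieldRing isField using (1≉0; inverse)
  open FieldFacts F isField
  open RingFacts F using (^·1≈·1^)
  open import Relation.Binary.Reasoning.Setoid setoid
  open import Algebra.Properties.Semiring.Exp semiring using () renaming (_^_ to _^ᴿ_)
  open import Algebra.Properties.Semiring.Mult semiring using () renaming (_×_ to _·_)
  open import Algebra.Properties.Group +-group using (∙-cancelʳ)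
  open Bijection card using (to; to⁻) renaming (cong to to-cong)
  module Sums = Enumeration +-commutativeMonoid card
  module Products = Enumeration *-commutativeMonoid card
  module SumProps = CommutativeMonoidSum +-commutativeMonoid
  module ProductProps = CommutativeMonoidSum *-commutativeMonoid
  open Sums using (_≈?_; to⁻∘to; to∘to⁻)

  -- N · 1 = 0: translating every element by 1 does not change their sum S,
  -- but adds N · 1 to it.
  size·1≈0 : N · 1# ≈ 0#
  size·1≈0 = ∙-cancelʳ S (N · 1#) 0# (begin
    N · 1# + S                  ≈⟨ +-congʳ (SumProps.sum-replicate N) ⟨
    Sums.total (λ _ → 1#) + S   ≈⟨ SumProps.∑-distrib-+ {N} (λ _ → 1#) to⁻ ⟨
    Sums.total (λ x → 1# + x)   ≈⟨ Sums.total-translate (-‿inverseˡ 1#) (λ x → x) (λ x≈y → x≈y) ⟨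
    S                           ≈⟨ +-identityˡ S ⟨
    0# + S                      ∎)
    where
    S : Carrier
    S = Sums.total (λ x → x)

  -- unzero w replaces w = 0 by 1, so its product over all elements has
  -- only nonzero factors.
  unzero : Carrier → Carrier
  unzero w with w ≈? 0#
  ... | yes _ = 1#
  ... | no  _ = w

  unzero-cong : ∀ {v w} → v ≈ w → unzero v ≈ unzero w
  unzero-cong {v} {w} v≈w with v ≈? 0# | w ≈? 0#
  ... | yes _   | yes _   = refl
  ... | yes v≈0 | no  w≉0 = ⊥-elim (w≉0 (trans (sym v≈w) v≈0))
  ... | no  v≉0 | yes w≈0 = ⊥-elim (v≉0 (trans v≈w w≈0))
  ... | no  _   | no  _   = v≈w

  unzero-nonzero : ∀ w → ¬ unzero w ≈ 0#
  unzero-nonzero w with w ≈? 0#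
  ... | yes _   = 1≉0
  ... | no  w≉0 = w≉0

  -- The factor by which multiplication by x changes unzero w: x, except 1 at w = 0.
  scaling : Carrier → Carrier → Carrier
  scaling x w with w ≈? 0#
  ... | yes _ = 1#
  ... | no  _ = x

  unzero-* : ∀ {x} → ¬ x ≈ 0# → ∀ w → unzero (x * w) ≈ scaling x w * unzero w
  unzero-* {x} x≉0 w with w ≈? 0# | (x * w) ≈? 0#
  ... | yes _   | yes _    = sym (*-identityˡ 1#)
  ... | yes w≈0 | no  xw≉0 = ⊥-elim (xw≉0 (trans (*-congˡ w≈0) (zeroʳ x)))
  ... | no  w≉0 | yes xw≈0 = ⊥-elim (*-nonzero x≉0 w≉0 xw≈0)
  ... | no  _   | no  _    = refl

  product-scaling : ∀ x → Products.total (scaling x) ≈ x ^ᴿ (N ∸ 1)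
  product-scaling x = sum-all-but-one *-commutativeMonoid (scaling x ∘ to⁻) (to 0#) at-zero elsewhere
    where
    at-zero : scaling x (to⁻ (to 0#)) ≈ 1#
    at-zero with to⁻ (to 0#) ≈? 0#
    ... | yes _ = refl
    ... | no  ≉0 = ⊥-elim (≉0 (to⁻∘to 0#))
    elsewhere : ∀ j → j ≢ to 0# → scaling x (to⁻ j) ≈ x
    elsewhere j j≢ with to⁻ j ≈? 0#
    ... | yes ≈0 = ⊥-elim (j≢ (≡.trans (≡.sym (to∘to⁻ j)) (to-cong ≈0)))
    ... | no  _  = refl

  -- Fermat: x^(N-1) = 1 for x ≠ 0.  Since w ↦ x w permutes the elements,
  -- the nonzero product P of unzero over all elements satisfies x^(N-1) P = P.
  fermat-unit : ∀ {x} → ¬ x ≈ 0# → x ^ᴿ (N ∸ 1) ≈ 1#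
  fermat-unit {x} x≉0 with inverse x x≉0
  ... | x⁻¹ , xx⁻¹≈1 = *-cancelʳ-nonzero P≉0 _ _ (begin
    x ^ᴿ (N ∸ 1) * P                               ≈⟨ *-congʳ (product-scaling x) ⟨
    Products.total (scaling x) * P                 ≈⟨ ProductProps.∑-distrib-+ {N} (scaling x ∘ to⁻) (unzero ∘ to⁻) ⟨
    Products.total (λ w → scaling x w * unzero w)  ≈⟨ ProductProps.sum-cong-≋ {N} (unzero-* x≉0 ∘ to⁻) ⟨
    Products.total (λ w → unzero (x * w))          ≈⟨ Products.total-translate x⁻¹x≈1 unzero unzero-cong ⟨
    P                                              ≈⟨ *-identityˡ P ⟨
    1# * P                                         ∎)
    where
    x⁻¹x≈1 : x⁻¹ * x ≈ 1#
    x⁻¹x≈1 = trans (*-comm x⁻¹ x) xx⁻¹≈1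
    P : Carrier
    P = Products.total unzero
    P≉0 : ¬ P ≈ 0#
    P≉0 = product-nonzero N (unzero ∘ to⁻) (unzero-nonzero ∘ to⁻)

  fermat : ∀ x → x ^ᴿ N ≈ x
  fermat x = begin
    x ^ᴿ N              ≡⟨ ≡.cong (x ^ᴿ_) (nonempty (to 0#)) ⟩
    x * x ^ᴿ (N ∸ 1)    ≈⟨ absorb (x ≈? 0#) ⟩
    x                   ∎
    where
    nonempty : ∀ {m} → Fin m → m ≡ suc (m ∸ 1)
    nonempty Fin.zero    = ≡.refl
    nonempty (Fin.suc _) = ≡.refl
    absorb : Dec (x ≈ 0#) → x * x ^ᴿ (N ∸ 1) ≈ x
    absorb (yes x≈0) = trans (*-congʳ x≈0) (trans (zeroˡ _) (sym x≈0))
    absorb (no  x≉0) = trans (*-congˡ (fermat-unit x≉0)) (*-identityʳ x)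

  -- The characteristic: if N = p ^ r with p prime then p · 1 = 0, because
  -- (p · 1) ^ r = N · 1 = 0 and F has no zero divisors.
  characteristic : ∀ p r → N ≡ p ^ r → p · 1# ≈ 0#
  characteristic p r N≡p^r with (p · 1#) ≈? 0#
  ... | yes p·1≈0 = p·1≈0
  ... | no  p·1≉0 = ⊥-elim (^-nonzero r p·1≉0 (begin
    (p · 1#) ^ᴿ r   ≈⟨ ^·1≈·1^ p r ⟨
    (p ^ r) · 1#    ≡⟨ ≡.cong (_· 1#) N≡p^r ⟨
    N · 1#          ≈⟨ size·1≈0 ⟩
    0#              ∎))

lemma2p5 : (q n : ℕ) → IsPrimePower q → n ≥ 1 →
    (F : CommutativeRing 0ℓ 0ℓ) → IsFiniteFieldOfSize F (q ^ n) →
    (b : Fin n → CommutativeRing.Carrier F) →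
    IsPresemifield F (starOp F q n b) →
    (A : CommutativeRing.Carrier F → CommutativeRing.Carrier F) →
    (∀ x → CommutativeRing._≈_ F (starOp F q n b (A x) (CommutativeRing.1# F)) x) →
    let open CommutativeRing F
        t = sumFin F n b
        d = 1# + Tr F q n t
    in ¬ (d ≈ 0#) ×
       (∀ (u : Carrier) → d * u ≈ 1# →
         ∀ x → A x ≈ x + Tr F q n ((- (t * x)) * u))
lemma2p5 q n (p , k , p-prime , _ , q≡p^k) _ F isFiniteField b presemifield A A∗1≈id = d≉0 , A-formula
  where
  open CommutativeRing F hiding (zero)
  open IsFiniteFieldOfSize isFiniteField
  open IsFieldRing isField using (1≉0)
  open IsPresemifield presemifield using (psf-noZeroDivisors)
  open RingFacts F
  open FiniteFieldFacts F isField card using (fermat; characteristic)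
  t : Carrier
  t = sumFin F n b

  -- F has q ^ n = p ^ (k n) elements, so characteristic p, and x ↦ x^q is additive.
  q-additive : Additive q
  q-additive = ≡.subst Additive (≡.sym q≡p^k) (additive-^ p p-additive k)
    where
    size≡p^kn : q ^ n ≡ p ^ (k ℕ.* n)
    size≡p^kn = ≡.trans (≡.cong (_^ n) q≡p^k) (ℕₚ.^-*-assoc p k n)
    p-additive : Additive p
    p-additive = freshman p-prime (characteristic p (k ℕ.* n) size≡p^kn)

  open Trace q n q-additive fermat
  open TraceEquation Fixed (Tr F q n) (Tr-cong q n) Tr-+ Tr-linear Tr-fixed

  -- d = 1 ∗ 1, which is nonzero since a presemifield has no zero divisors.
  d≉0 : ¬ (1# + Tr F q n t ≈ 0#)
  d≉0 d≈0 with psf-noZeroDivisors 1# 1# (trans 1∗1≈d d≈0)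
    where
    1∗1≈d : starOp F q n b 1# 1# ≈ 1# + Tr F q n t
    1∗1≈d = trans (star-by-one q n b 1#) (+-congˡ (Tr-cong q n (*-identityʳ t)))
  ... | inj₁ 1≈0 = 1≉0 1≈0
  ... | inj₂ 1≈0 = 1≉0 1≈0

  -- A(x) solves a + Tr(t a) = x, and the inverse u of d ∈ 𝔽_q lies in 𝔽_q.
  A-formula : ∀ u → (1# + Tr F q n t) * u ≈ 1# → ∀ x → A x ≈ x + Tr F q n ((- (t * x)) * u)
  A-formula u du≈1 x = solve (fixed-inverse (fixed-+ fixed-1 (Tr-fixed t)) du≈1)
                             (trans (sym (star-by-one q n b (A x))) (A∗1≈id x)) du≈1
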